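{- Let $2\le m\le n-1$, let $\hat B\in\mathbb{R}^{m\times n}$, let $\mathbf{b}\in\mathbb{R}^n$, and let $B=\begin{bmatrix}\hat B\\ \mathbf{b}^T\end{bmatrix}\in\mathbb{R}^{(m+1)\times n}$. (i) If $B$ has the strong inner product property, then $\hat B$ has the strong inner product property. (ii) If $\hat B$ has the strong inner product property, the rows of $B$ are linearly independent, and $\mathbf{b}$ is nowhere zero, then $B$ has the strong inner product property.
   Context: All matrices are real; $\circ$ denotes the Hadamard product. A vector is nowhere zero if all its entries are nonzero. A matrix $M\in\mathbb{R}^{k\times n}$ with $k\le n$ has the strong inner product property (SIPP) if $M$ has rank $k$ and $X=O$ is the only symmetric $k\times k$ matrix $X$ with $(XM)\circ M=O$. -}

module Defs where

open import Level using (Level; _⊔_) renaming (suc to lsuc)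
open import Data.Nat.Base using (ℕ; zero; suc)
open import Data.Fin.Base using (Fin; zero; suc)
open import Data.Product.Base using (Σ; _×_)
open import Relation.Nullary using (¬_)
open import Algebra.Bundles using (CommutativeRing)

record Field (c ℓ : Level) : Set (lsuc (c ⊔ ℓ)) where
  field
    commutativeRing : CommutativeRing c ℓ
  open CommutativeRing commutativeRing public
  field
    0≉1     : ¬ (0# ≈ 1#)
    inverse : ∀ x → ¬ (x ≈ 0#) → Σ Carrier (λ y → x * y ≈ 1#)

module FieldMatrices {c ℓ : Level} (F : Field c ℓ) where
  open Field F hiding (zero)

  Matrix : ℕ → ℕ → Set c
  Matrix k n = Fin k → Fin n → Carrier

  Vector : ℕ → Set c
  Vector n = Fin n → Carrier

  ∑ : ∀ {k} → (Fin k → Carrier) → Carrier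
  ∑ {zero}  f = 0#
  ∑ {suc k} f = f zero + ∑ (λ i → f (suc i))

  _⊗_ : ∀ {k l n} → Matrix k l → Matrix l n → Matrix k n
  (A ⊗ B) i j = ∑ (λ t → A i t * B t j)

  _∘ₕ_ : ∀ {k n} → Matrix k n → Matrix k n → Matrix k n
  (A ∘ₕ B) i j = A i j * B i j

  IsZeroMatrix : ∀ {k n} → Matrix k n → Set ℓ
  IsZeroMatrix A = ∀ i j → A i j ≈ 0#

  Symmetric : ∀ {k} → Matrix k k → Set ℓ
  Symmetric X = ∀ i j → X i j ≈ X j i

  -- the rows of M are linearly independent; for a k × n matrix with k ≤ n
  -- this is exactly  rank M = k
  RowsLinearlyIndependent : ∀ {k n} → Matrix k n → Set (c ⊔ ℓ)
  RowsLinearlyIndependent {k} M =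
    (a : Vector k) → (∀ j → ∑ (λ i → a i * M i j) ≈ 0#) → ∀ i → a i ≈ 0#

  NowhereZero : ∀ {n} → Vector n → Set ℓ
  NowhereZero v = ∀ j → ¬ (v j ≈ 0#)

  SIPP : ∀ {k n} → Matrix k n → Set (c ⊔ ℓ)
  SIPP {k} M =
    RowsLinearlyIndependent M ×
    ((X : Matrix k k) → Symmetric X → IsZeroMatrix ((X ⊗ M) ∘ₕ M) → IsZeroMatrix X)

  appendRow : ∀ {m n} → Matrix m n → Vector n → Matrix (suc m) n
  appendRow {zero}  B̂ b zero    = b
  appendRow {suc m} B̂ b zero    = B̂ zero
  appendRow {suc m} B̂ b (suc i) = appendRow (λ i′ → B̂ (suc i′)) b i

-- Write B for B̂ with the row b appended.  (i) A symmetric X annihilating B̂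
-- becomes, bordered by a zero row and column, a symmetric matrix annihilating
-- B; and a dependency among the rows of B̂ is one among the rows of B.
-- (ii) If X is symmetric and (XB) ∘ B = O, the last row of that identity reads
-- (xᵀB) ∘ bᵀ = 0 for the last row x of X; since b is nowhere zero, xᵀB = 0, so
-- x = 0 by independence of the rows of B.  By symmetry the last column of X
-- vanishes too, and then the leading block X̂ of X satisfies (X̂B̂) ∘ B̂ = O.
module Submission where

open import Defs
open import Level using (Level; _⊔_)
open import Data.Nat.Base using (ℕ; suc; _≤_)
open import Data.Product.Base using (_×_; _,_)
open import Data.Fin.Base using (Fin; zero; suc; inject₁; fromℕ)
open import Function.Base using (_∘_)
open import Relation.Nullary using (¬_)
open import Relation.Binary.PropositionalEquality as ≡ using (_≡_)

infixl 5 _∷ʳ_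

_∷ʳ_ : ∀ {a} {A : Set a} {m} → (Fin m → A) → A → Fin (suc m) → A
_∷ʳ_ {m = ℕ.zero} f x zero    = x
_∷ʳ_ {m = suc m}  f x zero    = f zero
_∷ʳ_ {m = suc m}  f x (suc i) = ((f ∘ suc) ∷ʳ x) i

∷ʳ-inject₁ : ∀ {a} {A : Set a} {m} (f : Fin m → A) (x : A) (i : Fin m) →
             (f ∷ʳ x) (inject₁ i) ≡ f i
∷ʳ-inject₁ f x zero    = ≡.refl
∷ʳ-inject₁ f x (suc i) = ∷ʳ-inject₁ (f ∘ suc) x i

∷ʳ-last : ∀ {a} {A : Set a} {m} (f : Fin m → A) (x : A) → (f ∷ʳ x) (fromℕ m) ≡ x
∷ʳ-last {m = ℕ.zero} f x = ≡.refl
∷ʳ-last {m = suc m}  f x = ∷ʳ-last (f ∘ suc) x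

data Inject₁OrLast : ∀ {m} → Fin (suc m) → Set where
  inject : ∀ {m} (i : Fin m) → Inject₁OrLast (inject₁ i)
  last   : ∀ {m} → Inject₁OrLast (fromℕ m)

inject₁OrLast : ∀ {m} (k : Fin (suc m)) → Inject₁OrLast k
inject₁OrLast {ℕ.zero} zero    = last
inject₁OrLast {suc m}  zero    = inject zero
inject₁OrLast {suc m}  (suc k) with inject₁OrLast k
... | inject i = inject (suc i)
... | last     = last

module _ {c ℓ : Level} (F : Field c ℓ) where
  open Field F hiding (zero)
  open FieldMatrices F
  open import Relation.Binary.Reasoning.Setoid setoid

  ∑-cong : ∀ {k} {f g : Fin k → Carrier} → (∀ i → f i ≈ g i) → ∑ f ≈ ∑ g
  ∑-cong {ℕ.zero} f≈g = refl
  ∑-cong {suc k}  f≈g = +-cong (f≈g zero) (∑-cong (f≈g ∘ suc))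

  ∑-init-last : ∀ {k} (f : Fin (suc k) → Carrier) → ∑ f ≈ ∑ (f ∘ inject₁) + f (fromℕ k)
  ∑-init-last {ℕ.zero} f = +-comm (f zero) 0#
  ∑-init-last {suc k}  f = trans (+-congˡ (∑-init-last (f ∘ suc))) (sym (+-assoc _ _ _))

  x*y≈0⇒x≈0 : ∀ {x y} → x * y ≈ 0# → ¬ (y ≈ 0#) → x ≈ 0#
  x*y≈0⇒x≈0 {x} {y} xy≈0 y≉0 with inverse y y≉0
  ... | y⁻¹ , yy⁻¹≈1 = begin
    x              ≈⟨ sym (*-identityʳ x) ⟩
    x * 1#         ≈⟨ *-congˡ (sym yy⁻¹≈1) ⟩
    x * (y * y⁻¹)  ≈⟨ sym (*-assoc x y y⁻¹) ⟩
    (x * y) * y⁻¹  ≈⟨ *-congʳ xy≈0 ⟩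
    0# * y⁻¹       ≈⟨ zeroˡ y⁻¹ ⟩
    0#             ∎

  -- aᵀM; note that (X ⊗ M) i is definitionally rowCombination (X i) M.
  rowCombination : ∀ {k n} → Vector k → Matrix k n → Vector n
  rowCombination a M j = ∑ (λ i → a i * M i j)

  rowCombination-cong : ∀ {k n} {a a′ : Vector k} (M : Matrix k n) →
                        (∀ i → a i ≈ a′ i) → ∀ j → rowCombination a M j ≈ rowCombination a′ M j
  rowCombination-cong M a≈a′ j = ∑-cong (λ i → *-congʳ (a≈a′ i))

  rowCombination-zeroˡ : ∀ {k n} {a : Vector k} (M : Matrix k n) →
                         (∀ i → a i ≈ 0#) → ∀ j → rowCombination a M j ≈ 0#
  rowCombination-zeroˡ {ℕ.zero} M a≈0 j = refl
  rowCombination-zeroˡ {suc k} {a = a} M a≈0 j = begin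
    rowCombination a M j                       ≈⟨ +-cong (trans (*-congʳ (a≈0 zero)) (zeroˡ _))
                                                    (rowCombination-zeroˡ (M ∘ suc) (a≈0 ∘ suc) j) ⟩
    0# + 0#                                    ≈⟨ +-identityˡ 0# ⟩
    0#                                         ∎

  appendRow-inject₁ : ∀ {m n} (B̂ : Matrix m n) (b : Vector n) (i : Fin m) →
                      appendRow B̂ b (inject₁ i) ≡ B̂ i
  appendRow-inject₁ {suc m} B̂ b zero    = ≡.refl
  appendRow-inject₁ {suc m} B̂ b (suc i) = appendRow-inject₁ (B̂ ∘ suc) b i

  appendRow-last : ∀ {m n} (B̂ : Matrix m n) (b : Vector n) → appendRow B̂ b (fromℕ m) ≡ b
  appendRow-last {ℕ.zero} B̂ b = ≡.refl
  appendRow-last {suc m}  B̂ b = appendRow-last (B̂ ∘ suc) b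

  rowCombination-appendRow : ∀ {m n} (B̂ : Matrix m n) (b : Vector n) (a : Vector (suc m)) j →
    rowCombination a (appendRow B̂ b) j ≈ rowCombination (a ∘ inject₁) B̂ j + a (fromℕ m) * b j
  rowCombination-appendRow {m} B̂ b a j = begin
    rowCombination a (appendRow B̂ b) j
      ≈⟨ ∑-init-last (λ i → a i * appendRow B̂ b i j) ⟩
    ∑ (λ i → a (inject₁ i) * appendRow B̂ b (inject₁ i) j) + a (fromℕ m) * appendRow B̂ b (fromℕ m) j
      ≈⟨ +-cong (∑-cong (λ i → *-congˡ (reflexive (≡.cong-app (appendRow-inject₁ B̂ b i) j))))
                (*-congˡ (reflexive (≡.cong-app (appendRow-last B̂ b) j))) ⟩
    rowCombination (a ∘ inject₁) B̂ j + a (fromℕ m) * b j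
      ∎

  rowCombination-appendRow-last≈0 : ∀ {m n} (B̂ : Matrix m n) (b : Vector n) (a : Vector (suc m)) →
    a (fromℕ m) ≈ 0# → ∀ j → rowCombination a (appendRow B̂ b) j ≈ rowCombination (a ∘ inject₁) B̂ j
  rowCombination-appendRow-last≈0 {m} B̂ b a aₘ≈0 j = begin
    rowCombination a (appendRow B̂ b) j                    ≈⟨ rowCombination-appendRow B̂ b a j ⟩
    rowCombination (a ∘ inject₁) B̂ j + a (fromℕ m) * b j  ≈⟨ +-congˡ (trans (*-congʳ aₘ≈0) (zeroˡ (b j))) ⟩
    rowCombination (a ∘ inject₁) B̂ j + 0#                 ≈⟨ +-identityʳ _ ⟩
    rowCombination (a ∘ inject₁) B̂ j                      ∎

  rowCombination-appendRow-∷ʳ0 : ∀ {m n} (B̂ : Matrix m n) (b : Vector n) (a : Vector m) j →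
    rowCombination (a ∷ʳ 0#) (appendRow B̂ b) j ≈ rowCombination a B̂ j
  rowCombination-appendRow-∷ʳ0 B̂ b a j =
    trans (rowCombination-appendRow-last≈0 B̂ b (a ∷ʳ 0#) (reflexive (∷ʳ-last a 0#)) j)
          (rowCombination-cong B̂ (reflexive ∘ ∷ʳ-inject₁ a 0#) j)

  TrivialSymmetricAnnihilator : ∀ {k n} → Matrix k n → Set (c ⊔ ℓ)
  TrivialSymmetricAnnihilator {k} M =
    (X : Matrix k k) → Symmetric X → IsZeroMatrix ((X ⊗ M) ∘ₕ M) → IsZeroMatrix X

  borderByZero : ∀ {m} → Matrix m m → Matrix (suc m) (suc m)
  borderByZero X = (λ i → X i ∷ʳ 0#) ∷ʳ (λ _ → 0#)

  module _ {m} (X : Matrix m m) where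

    borderByZero-inject₁ : ∀ i → borderByZero X (inject₁ i) ≡ X i ∷ʳ 0#
    borderByZero-inject₁ = ∷ʳ-inject₁ (λ i → X i ∷ʳ 0#) (λ _ → 0#)

    borderByZero-inner : ∀ i i′ → borderByZero X (inject₁ i) (inject₁ i′) ≈ X i i′
    borderByZero-inner i i′ rewrite borderByZero-inject₁ i = reflexive (∷ʳ-inject₁ (X i) 0# i′)

    borderByZero-lastColumn : ∀ i → borderByZero X (inject₁ i) (fromℕ m) ≈ 0#
    borderByZero-lastColumn i rewrite borderByZero-inject₁ i = reflexive (∷ʳ-last (X i) 0#)

    borderByZero-lastRow : ∀ k → borderByZero X (fromℕ m) k ≈ 0#
    borderByZero-lastRow k = reflexive (≡.cong-app (∷ʳ-last (λ i → X i ∷ʳ 0#) (λ _ → 0#)) k)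

    borderByZero-symmetric : Symmetric X → Symmetric (borderByZero X)
    borderByZero-symmetric symX k k′ with inject₁OrLast k | inject₁OrLast k′
    ... | inject i | inject i′ = trans (borderByZero-inner i i′)
                                   (trans (symX i i′) (sym (borderByZero-inner i′ i)))
    ... | inject i | last      = trans (borderByZero-lastColumn i) (sym (borderByZero-lastRow _))
    ... | last     | inject i′ = trans (borderByZero-lastRow _) (sym (borderByZero-lastColumn i′))
    ... | last     | last      = refl

  independent-appendRow⁻ : ∀ {m n} (B̂ : Matrix m n) (b : Vector n) →
    RowsLinearlyIndependent (appendRow B̂ b) → RowsLinearlyIndependent B̂
  independent-appendRow⁻ B̂ b indB a aB̂≈0 i =
    trans (reflexive (≡.sym (∷ʳ-inject₁ a 0# i)))
          (indB (a ∷ʳ 0#) (λ j → trans (rowCombination-appendRow-∷ʳ0 B̂ b a j) (aB̂≈0 j)) (inject₁ i))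

  trivialSymmetricAnnihilator-appendRow⁻ : ∀ {m n} (B̂ : Matrix m n) (b : Vector n) →
    TrivialSymmetricAnnihilator (appendRow B̂ b) → TrivialSymmetricAnnihilator B̂
  trivialSymmetricAnnihilator-appendRow⁻ B̂ b trivB X symX XB̂∘B̂≈0 i i′ =
    trans (sym (borderByZero-inner X i i′))
          (trivB (borderByZero X) (borderByZero-symmetric X symX) annihilates (inject₁ i) (inject₁ i′))
    where
    B = appendRow B̂ b
    annihilates : IsZeroMatrix ((borderByZero X ⊗ B) ∘ₕ B)
    annihilates k j with inject₁OrLast k
    ... | inject i rewrite borderByZero-inject₁ X i | appendRow-inject₁ B̂ b i =
      trans (*-congʳ (rowCombination-appendRow-∷ʳ0 B̂ b (X i) j)) (XB̂∘B̂≈0 i j)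
    ... | last =
      trans (*-congʳ (rowCombination-zeroˡ B (borderByZero-lastRow X) j)) (zeroˡ _)

  trivialSymmetricAnnihilator-appendRow⁺ : ∀ {m n} (B̂ : Matrix m n) (b : Vector n) →
    TrivialSymmetricAnnihilator B̂ → RowsLinearlyIndependent (appendRow B̂ b) → NowhereZero b →
    TrivialSymmetricAnnihilator (appendRow B̂ b)
  trivialSymmetricAnnihilator-appendRow⁺ {m} B̂ b trivB̂ indB b≉0 X symX XB∘B≈0 = X≈0
    where
    B = appendRow B̂ b
    lastRow≈0 : ∀ k → X (fromℕ m) k ≈ 0#
    lastRow≈0 = indB (X (fromℕ m)) (λ j → x*y≈0⇒x≈0
      (trans (*-congˡ (reflexive (≡.cong-app (≡.sym (appendRow-last B̂ b)) j))) (XB∘B≈0 (fromℕ m) j))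
      (b≉0 j))
    X̂ : Matrix m m
    X̂ i i′ = X (inject₁ i) (inject₁ i′)
    X̂B̂∘B̂≈0 : IsZeroMatrix ((X̂ ⊗ B̂) ∘ₕ B̂)
    X̂B̂∘B̂≈0 i j = begin
      rowCombination (X̂ i) B̂ j * B̂ i j
        ≈⟨ *-cong (sym (rowCombination-appendRow-last≈0 B̂ b (X (inject₁ i)) (trans (symX _ _) (lastRow≈0 _)) j))
                  (reflexive (≡.cong-app (≡.sym (appendRow-inject₁ B̂ b i)) j)) ⟩
      rowCombination (X (inject₁ i)) B j * B (inject₁ i) j
        ≈⟨ XB∘B≈0 (inject₁ i) j ⟩
      0# ∎
    X̂≈0 : IsZeroMatrix X̂
    X̂≈0 = trivB̂ X̂ (λ i i′ → symX _ _) X̂B̂∘B̂≈0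
    X≈0 : IsZeroMatrix X
    X≈0 k k′ with inject₁OrLast k | inject₁OrLast k′
    ... | inject i | inject i′ = X̂≈0 i i′
    ... | inject i | last      = trans (symX _ _) (lastRow≈0 _)
    ... | last     | _         = lastRow≈0 k′

proposition3p9 : ∀ {c ℓ : Level} (F : Field c ℓ) (m n : ℕ) → 2 ≤ m → suc m ≤ n →
    let open FieldMatrices F in
    (B̂ : Matrix m n) (b : Vector n) →
      (SIPP (appendRow B̂ b) → SIPP B̂) ×
      (SIPP B̂ → RowsLinearlyIndependent (appendRow B̂ b) → NowhereZero b → SIPP (appendRow B̂ b))
proposition3p9 F m n _ _ B̂ b = part-i , part-ii
  where
  open FieldMatrices F
  part-i : SIPP (appendRow B̂ b) → SIPP B̂
  part-i (indB , trivB) =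
    independent-appendRow⁻ F B̂ b indB , trivialSymmetricAnnihilator-appendRow⁻ F B̂ b trivB
  part-ii : SIPP B̂ → RowsLinearlyIndependent (appendRow B̂ b) → NowhereZero b → SIPP (appendRow B̂ b)
  part-ii (_ , trivB̂) indB b≉0 =
    indB , trivialSymmetricAnnihilator-appendRow⁺ F B̂ b trivB̂ indB b≉0
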